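{- Let $p$ be a prime and let $a\ge 2$, $b\ge 0$, $c\ge 2$ be integers with $p>a$. Let $(i,j)\in\mathcal{N}$. Let $u_j,v_j$ be the unique integers with $j-1+(a-1)(p-1)=p(u_j-1)+av_j$, $1\le u_j\le a$, $0\le v_j\le p-1$. Let $k_0,\dots,k_c$ be integers with $0\le k_0,\dots,k_c\le v_j$, $k_0+k_1+\dots+k_c=v_j$, and $p\mid bv_j+ck_c+(c-1)k_{c-1}+\dots+k_1+i$, and put \[ s_{i,j}(k_0,\dots,k_c)=\frac{bv_j+ck_c+(c-1)k_{c-1}+\dots+k_1+i}{p}. \] Then \[ u_j\le\left\lceil -\frac{a}{b+c}\,s_{i,j}(k_0,\dots,k_c)+a\right\rceil-1 . \]
   Context: $\mathcal{N}$ denotes the set of lattice points in the interior of the Newton polygon of $y^a-x^bf(x)$ with $\deg f=c$, $f(0)\neq 0$, namely \[ \mathcal{N}=\Big\{(i,j)\in\mathbb{Z}^2:\ \big(1\le i\le b\ \text{and}\ \lfloor -\tfrac{a}{b}i+a\rfloor+1\le j\le\lceil -\tfrac{a}{b+c}i+a\rceil-1\big)\ \text{or}\ \big(b+1\le i\le b+c-1\ \text{and}\ 1\le j\le\lceil -\tfrac{a}{b+c}i+a\rceil-1\big)\Big\}. \] -}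

module Defs where

open import Data.Nat as ℕ using (ℕ; zero; suc)
open import Data.Fin using (Fin; toℕ) renaming (zero to fzero; suc to fsuc)
open import Data.Integer as ℤ using (ℤ; +_)
open import Data.Rational as ℚ using (ℚ; floor; ceiling)
open import Data.Product using (_×_)
open import Data.Sum using (_⊎_)

-- the rational number  -(a/d)*x + a ,  for d ≥ 1.
-- For d = 0 the value is irrelevant (never used under the hypotheses: the
-- first branch of 𝒩 needs 1 ≤ i ≤ b, and b + c ≥ 2); we set it to 0.
line : ℕ → ℕ → ℚ → ℚ
line a zero    x = ℚ.0ℚ
line a (suc d) x = ℚ.- ((+ a) ℚ./ suc d) ℚ.* x ℚ.+ ((+ a) ℚ./ 1)

ι : ℤ → ℚ
ι z = z ℚ./ 1

-- The set 𝒩 of interior lattice points of the Newton polygon of y^a - x^b f(x), deg f = c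
InN : (a b c : ℕ) → ℤ → ℤ → Set
InN a b c i j =
  ( (+ 1 ℤ.≤ i × i ℤ.≤ + b)
    × (floor (line a b (ι i)) ℤ.+ + 1 ℤ.≤ j
    ×  j ℤ.≤ ceiling (line a (b ℕ.+ c) (ι i)) ℤ.- + 1) )
  ⊎
  ( (+ (b ℕ.+ 1) ℤ.≤ i × i ℤ.≤ + (b ℕ.+ c) ℤ.- + 1)
    × (+ 1 ℤ.≤ j
    ×  j ℤ.≤ ceiling (line a (b ℕ.+ c) (ι i)) ℤ.- + 1) )

sumFin : (n : ℕ) → (Fin n → ℤ) → ℤ
sumFin zero    f = + 0
sumFin (suc n) f = f fzero ℤ.+ sumFin n (λ t → f (fsuc t))

total : (c : ℕ) → (Fin (suc c) → ℤ) → ℤ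
total c k = sumFin (suc c) k

weighted : (c : ℕ) → (Fin (suc c) → ℤ) → ℤ
weighted c k = sumFin (suc c) (λ t → + toℕ t ℤ.* k t)

module Submission where

-- Write D = b + c and N = b v + (c k_c + … + k_1) + i, so that
-- s = N/p.  For integers n and rationals x one has  n ≤ ⌈x⌉ - 1  iff  n < x,
-- and after clearing denominators
--   n < a - (a/D)(N/Q)   iff   n·DQ + a·N < a·DQ.
-- Hence the hypothesis (i, j) ∈ 𝒩 gives  j·D + a·i < a·D,  and the claim is
-- u·Dp + a·N < a·Dp.  The latter follows from the former by pure integer
-- arithmetic: the digit relation gives  p·u + a·v = j + a·p - a,  and the
-- weights 0, 1, …, c of the k_t are at most c, so  N ≤ D·v + i  because
-- k_0 + … + k_c = v.

open import Defs
open import Data.Nat as ℕ using (ℕ; zero; suc; NonZero)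
open import Data.Nat.Primality using (Prime)
open import Data.Nat.Coprimality using (Coprime)
import Data.Nat.Properties as ℕP
open import Data.Fin using (Fin; toℕ) renaming (zero to fzero; suc to fsuc)
import Data.Fin.Properties as FinP
open import Data.Integer as ℤ using (ℤ; +_)
import Data.Integer.Properties as ℤP
open import Data.Integer.Divisibility using (_∣_)
open import Data.Integer.DivMod using (a≡a%n+[a/n]*n; n%d<d)
open import Data.Integer.Tactic.RingSolver using (solve-∀; solve)
open import Data.Rational as ℚ using (ℚ; ceiling; floor)
import Data.Rational.Properties as ℚP
import Data.Rational.Unnormalised as U
import Data.Rational.Unnormalised.Properties as UP
open import Data.List using (_∷_; [])
open import Data.Product using (proj₂)
open import Data.Sum using ([_,_])
open import Function using (_⇔_; mk⇔; Equivalence; _∘_)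
open import Function.Related.Propositional using (module EquationalReasoning)
open import Relation.Binary.PropositionalEquality using (_≡_; refl; sym; cong; cong₂; subst; module ≡-Reasoning)

<-minus⇔+< : ∀ (i j k : ℤ) → i ℤ.< j ℤ.- k ⇔ i ℤ.+ k ℤ.< j
<-minus⇔+< i j k = mk⇔
  (λ h → subst (i ℤ.+ k ℤ.<_) (subtract-add j k) (ℤP.+-monoˡ-< k h))
  (λ h → subst (ℤ._< j ℤ.- k) (cancel i k) (ℤP.+-monoˡ-< (ℤ.- k) h))
  where
  subtract-add : ∀ x y → x ℤ.- y ℤ.+ y ≡ x
  subtract-add = solve-∀
  cancel : ∀ x y → x ℤ.+ y ℤ.- y ≡ x
  cancel = solve-∀

/-<⇔<* : ∀ (m q : ℤ) (k : ℕ) → m ℤ./ + suc k ℤ.< q ⇔ m ℤ.< q ℤ.* + suc k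
/-<⇔<* m q k = mk⇔ to from
  where
  d = + suc k
  r = + (m ℤ.% d)
  ⌊m/d⌋ = m ℤ./ d
  division : m ≡ r ℤ.+ ⌊m/d⌋ ℤ.* d
  division = a≡a%n+[a/n]*n m d
  r<d : r ℤ.< d
  r<d = ℤ.+<+ (n%d<d m d)
  open ℤP.≤-Reasoning
  to : ⌊m/d⌋ ℤ.< q → m ℤ.< q ℤ.* d
  to h = begin-strict
    m                         ≡⟨ division ⟩
    r ℤ.+ ⌊m/d⌋ ℤ.* d         <⟨ ℤP.+-monoˡ-< (⌊m/d⌋ ℤ.* d) r<d ⟩
    d ℤ.+ ⌊m/d⌋ ℤ.* d         ≡⟨ ℤP.suc-* ⌊m/d⌋ d ⟨
    ℤ.suc ⌊m/d⌋ ℤ.* d         ≤⟨ ℤP.*-monoʳ-≤-nonNeg d (ℤP.i<j⇒suc[i]≤j h) ⟩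
    q ℤ.* d                   ∎
  from : m ℤ.< q ℤ.* d → ⌊m/d⌋ ℤ.< q
  from h = ℤP.≰⇒> λ q≤⌊m/d⌋ → ℤP.<-irrefl refl (begin-strict
    m                         <⟨ h ⟩
    q ℤ.* d                   ≤⟨ ℤP.*-monoʳ-≤-nonNeg d q≤⌊m/d⌋ ⟩
    ⌊m/d⌋ ℤ.* d               ≤⟨ ℤP.i≤j+i (⌊m/d⌋ ℤ.* d) r ⟩
    r ℤ.+ ⌊m/d⌋ ℤ.* d         ≡⟨ sym division ⟩
    m                         ∎)

≤-1⇔< : ∀ (i j : ℤ) → i ℤ.≤ j ℤ.- + 1 ⇔ i ℤ.< j
≤-1⇔< i j = mk⇔
  (λ h → ℤP.i≤pred[j]⇒i<j (subst (i ℤ.≤_) (ℤP.+-comm j ℤ.-1ℤ) h))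
  (λ h → subst (i ℤ.≤_) (ℤP.+-comm ℤ.-1ℤ j) (ℤP.i<j⇒i≤pred[j] h))

<-neg⇔ : ∀ (i j : ℤ) → i ℤ.< ℤ.- j ⇔ j ℤ.< ℤ.- i
<-neg⇔ i j = mk⇔ (swap i j) (swap j i)
  where
  swap : ∀ i j → i ℤ.< ℤ.- j → j ℤ.< ℤ.- i
  swap i j h = subst (ℤ._< ℤ.- i) (ℤP.neg-involutive j) (ℤP.neg-mono-< h)

neg-<⇔ : ∀ (i j : ℤ) → ℤ.- i ℤ.< ℤ.- j ⇔ j ℤ.< i
neg-<⇔ i j = mk⇔ ℤP.neg-cancel-< ℤP.neg-mono-<

floor-neg : ∀ N k .(c : Coprime ℤ.∣ N ∣ (suc k)) → floor (ℚ.- ℚ.mkℚ N k c) ≡ (ℤ.- N) ℤ./ + suc k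
floor-neg (+ 0)      k c = refl
floor-neg ℤ.+[1+ m ] k c = refl
floor-neg ℤ.-[1+ m ] k c = refl

≤⌈⌉-1⇔< : ∀ (n : ℤ) (x : ℚ) → n ℤ.≤ ceiling x ℤ.- + 1 ⇔ (n U./ 1) U.< ℚ.toℚᵘ x
≤⌈⌉-1⇔< n x@(ℚ.mkℚ N k c) = begin
  n ℤ.≤ ceiling x ℤ.- + 1               ∼⟨ ≤-1⇔< n (ceiling x) ⟩
  n ℤ.< ℤ.- floor (ℚ.- x)              ∼⟨ <-neg⇔ n (floor (ℚ.- x)) ⟩
  floor (ℚ.- x) ℤ.< ℤ.- n              ≡⟨ cong (ℤ._< ℤ.- n) (floor-neg N k c) ⟩
  (ℤ.- N) ℤ./ d ℤ.< ℤ.- n              ∼⟨ /-<⇔<* (ℤ.- N) (ℤ.- n) k ⟩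
  ℤ.- N ℤ.< ℤ.- n ℤ.* d                ≡⟨ cong (ℤ.- N ℤ.<_) (sym (ℤP.neg-distribˡ-* n d)) ⟩
  ℤ.- N ℤ.< ℤ.- (n ℤ.* d)              ∼⟨ neg-<⇔ N (n ℤ.* d) ⟩
  n ℤ.* d ℤ.< N                        ≡⟨ cong (n ℤ.* d ℤ.<_) (sym (ℤP.*-identityʳ N)) ⟩
  n ℤ.* d ℤ.< N ℤ.* + 1                ∼⟨ mk⇔ U.*<* (λ { (U.*<* h) → h }) ⟩
  (n U./ 1) U.< ℚ.toℚᵘ x               ∎
  where
  d = + suc k
  open EquationalReasoning

lineᵘ : ℕ → ℕ → U.ℚᵘ → U.ℚᵘ
lineᵘ a d y = (U.- (+ a U./ suc d)) U.* y U.+ (+ a U./ 1)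

toℚᵘ-line : ∀ a d x → ℚ.toℚᵘ (line a (suc d) x) U.≃ lineᵘ a d (ℚ.toℚᵘ x)
toℚᵘ-line a d x = UP.≃-trans (ℚP.toℚᵘ-homo-+ (ℚ.- slope ℚ.* x) height)
  (UP.+-cong (UP.≃-trans (ℚP.toℚᵘ-homo-* (ℚ.- slope) x)
                         (UP.*-congʳ (UP.≃-trans (ℚP.toℚᵘ-homo‿- slope) (UP.-‿cong (ℚP.toℚᵘ-fromℚᵘ _)))))
             (ℚP.toℚᵘ-fromℚᵘ _))
  where
  slope = (+ a) ℚ./ suc d
  height = (+ a) ℚ./ 1

<-respʳ-≃⇔ : ∀ {x y z : U.ℚᵘ} → y U.≃ z → x U.< y ⇔ x U.< z
<-respʳ-≃⇔ y≃z = mk⇔ (UP.<-respʳ-≃ y≃z) (UP.<-respʳ-≃ (UP.≃-sym y≃z))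

below-lineᵘ⇔ : ∀ (a d q : ℕ) (n N : ℤ) →
  (n U./ 1) U.< lineᵘ a d (N U./ suc q) ⇔
  n ℤ.* (+ suc d ℤ.* + suc q) ℤ.+ + a ℤ.* N ℤ.< + a ℤ.* (+ suc d ℤ.* + suc q)
below-lineᵘ⇔ a d q n N = begin
  (n U./ 1) U.< lineᵘ a d (N U./ suc q)                      ∼⟨ mk⇔ (λ { (U.*<* h) → h }) U.*<* ⟩
  n ℤ.* (DQ ℤ.* + 1) ℤ.< (ℤ.- A ℤ.* N ℤ.* + 1 ℤ.+ A ℤ.* DQ) ℤ.* + 1
                                                             ≡⟨ cong₂ ℤ._<_ (lhs n DQ) (rhs A N DQ) ⟩
  n ℤ.* DQ ℤ.< A ℤ.* DQ ℤ.- A ℤ.* N                          ∼⟨ <-minus⇔+< (n ℤ.* DQ) (A ℤ.* DQ) (A ℤ.* N) ⟩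
  n ℤ.* DQ ℤ.+ A ℤ.* N ℤ.< A ℤ.* DQ                          ∎
  where
  A = + a
  DQ = + suc d ℤ.* + suc q
  lhs : ∀ n DQ → n ℤ.* (DQ ℤ.* + 1) ≡ n ℤ.* DQ
  lhs = solve-∀
  rhs : ∀ A N DQ → (ℤ.- A ℤ.* N ℤ.* + 1 ℤ.+ A ℤ.* DQ) ℤ.* + 1 ≡ A ℤ.* DQ ℤ.- A ℤ.* N
  rhs = solve-∀
  open EquationalReasoning

≤⌈line⌉-1⇔ : ∀ (a D : ℕ) .{{_ : NonZero D}} (Q : ℕ) .{{_ : NonZero Q}} (n N : ℤ) →
  n ℤ.≤ ceiling (line a D (N ℚ./ Q)) ℤ.- + 1 ⇔
  n ℤ.* (+ D ℤ.* + Q) ℤ.+ + a ℤ.* N ℤ.< + a ℤ.* (+ D ℤ.* + Q)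
≤⌈line⌉-1⇔ a (suc d) (suc q) n N = begin
  n ℤ.≤ ceiling (line a (suc d) x) ℤ.- + 1           ∼⟨ ≤⌈⌉-1⇔< n (line a (suc d) x) ⟩
  (n U./ 1) U.< ℚ.toℚᵘ (line a (suc d) x)             ∼⟨ <-respʳ-≃⇔ (toℚᵘ-line a d x) ⟩
  (n U./ 1) U.< lineᵘ a d (ℚ.toℚᵘ x)                  ∼⟨ <-respʳ-≃⇔ (lineᵘ-cong (ℚP.toℚᵘ-fromℚᵘ (N U./ suc q))) ⟩
  (n U./ 1) U.< lineᵘ a d (N U./ suc q)               ∼⟨ below-lineᵘ⇔ a d q n N ⟩
  n ℤ.* (+ suc d ℤ.* + suc q) ℤ.+ + a ℤ.* N ℤ.< + a ℤ.* (+ suc d ℤ.* + suc q) ∎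
  where
  x = N ℚ./ suc q
  lineᵘ-cong : ∀ {y z} → y U.≃ z → lineᵘ a d y U.≃ lineᵘ a d z
  lineᵘ-cong y≃z = UP.+-congˡ (+ a U./ 1) (UP.*-congˡ {U.- (+ a U./ suc d)} y≃z)
  open EquationalReasoning

sumFin-weighted≤ : ∀ n (g k : Fin n → ℤ) (m : ℤ) → (∀ t → g t ℤ.≤ m) → (∀ t → + 0 ℤ.≤ k t) →
  sumFin n (λ t → g t ℤ.* k t) ℤ.≤ m ℤ.* sumFin n k
sumFin-weighted≤ zero    g k m g≤m k≥0 = ℤP.≤-reflexive (sym (ℤP.*-zeroʳ m))
sumFin-weighted≤ (suc n) g k m g≤m k≥0 = begin
  g fzero ℤ.* k fzero ℤ.+ sumFin n (λ t → g (fsuc t) ℤ.* k (fsuc t))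
    ≤⟨ ℤP.+-mono-≤ (ℤP.*-monoʳ-≤-nonNeg (k fzero) {{ℤ.nonNegative (k≥0 fzero)}} (g≤m fzero))
                   (sumFin-weighted≤ n (g ∘ fsuc) (k ∘ fsuc) m (g≤m ∘ fsuc) (k≥0 ∘ fsuc)) ⟩
  m ℤ.* k fzero ℤ.+ m ℤ.* sumFin n (k ∘ fsuc)
    ≡⟨ ℤP.*-distribˡ-+ m (k fzero) (sumFin n (k ∘ fsuc)) ⟨
  m ℤ.* sumFin (suc n) k ∎
  where open ℤP.≤-Reasoning

weighted≤c*total : ∀ c (k : Fin (suc c) → ℤ) → (∀ t → + 0 ℤ.≤ k t) → weighted c k ℤ.≤ + c ℤ.* total c k
weighted≤c*total c k k≥0 =
  sumFin-weighted≤ (suc c) (λ t → + toℕ t) k (+ c) (λ t → ℤ.+≤+ (ℕP.≤-pred (FinP.toℕ<n t))) k≥0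

digit-relation : ∀ (a p u v j : ℤ) →
  j ℤ.- + 1 ℤ.+ (a ℤ.- + 1) ℤ.* (p ℤ.- + 1) ≡ p ℤ.* (u ℤ.- + 1) ℤ.+ a ℤ.* v →
  p ℤ.* u ℤ.+ a ℤ.* v ≡ j ℤ.+ a ℤ.* p ℤ.- a
digit-relation a p u v j E = begin
  p ℤ.* u ℤ.+ a ℤ.* v                                   ≡⟨ solve (p ∷ u ∷ a ∷ v ∷ []) ⟩
  p ℤ.* (u ℤ.- + 1) ℤ.+ a ℤ.* v ℤ.+ p                   ≡⟨ cong (ℤ._+ p) E ⟨
  j ℤ.- + 1 ℤ.+ (a ℤ.- + 1) ℤ.* (p ℤ.- + 1) ℤ.+ p       ≡⟨ solve (j ∷ a ∷ p ∷ []) ⟩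
  j ℤ.+ a ℤ.* p ℤ.- a                                   ∎
  where open ≡-Reasoning

below-line-transfer : ∀ (a p u v i j D N : ℤ) .{{_ : ℤ.NonNegative a}} →
  j ℤ.- + 1 ℤ.+ (a ℤ.- + 1) ℤ.* (p ℤ.- + 1) ≡ p ℤ.* (u ℤ.- + 1) ℤ.+ a ℤ.* v →
  N ℤ.≤ D ℤ.* v ℤ.+ i →
  j ℤ.* (D ℤ.* + 1) ℤ.+ a ℤ.* i ℤ.< a ℤ.* (D ℤ.* + 1) →
  u ℤ.* (D ℤ.* p) ℤ.+ a ℤ.* N ℤ.< a ℤ.* (D ℤ.* p)
below-line-transfer a p u v i j D N E N≤ ij-below = begin-strict
  u ℤ.* (D ℤ.* p) ℤ.+ a ℤ.* N
    ≤⟨ ℤP.+-monoʳ-≤ (u ℤ.* (D ℤ.* p)) (ℤP.*-monoˡ-≤-nonNeg a N≤) ⟩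
  u ℤ.* (D ℤ.* p) ℤ.+ a ℤ.* (D ℤ.* v ℤ.+ i)
    ≡⟨ solve (u ∷ D ∷ p ∷ a ∷ v ∷ i ∷ []) ⟩
  D ℤ.* (p ℤ.* u ℤ.+ a ℤ.* v) ℤ.+ a ℤ.* i
    ≡⟨ cong (λ x → D ℤ.* x ℤ.+ a ℤ.* i) (digit-relation a p u v j E) ⟩
  D ℤ.* (j ℤ.+ a ℤ.* p ℤ.- a) ℤ.+ a ℤ.* i
    ≡⟨ solve (D ∷ j ∷ a ∷ p ∷ i ∷ []) ⟩
  (j ℤ.* (D ℤ.* + 1) ℤ.+ a ℤ.* i) ℤ.+ (a ℤ.* (D ℤ.* p) ℤ.- a ℤ.* (D ℤ.* + 1))
    <⟨ ℤP.+-monoˡ-< (a ℤ.* (D ℤ.* p) ℤ.- a ℤ.* (D ℤ.* + 1)) ij-below ⟩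
  a ℤ.* (D ℤ.* + 1) ℤ.+ (a ℤ.* (D ℤ.* p) ℤ.- a ℤ.* (D ℤ.* + 1))
    ≡⟨ solve (a ∷ D ∷ p ∷ []) ⟩
  a ℤ.* (D ℤ.* p) ∎
  where open ℤP.≤-Reasoning

numerator≤ : ∀ b c (k : Fin (suc c) → ℤ) (v i : ℤ) → (∀ t → + 0 ℤ.≤ k t) → total c k ≡ v →
  + b ℤ.* v ℤ.+ weighted c k ℤ.+ i ℤ.≤ + (b ℕ.+ c) ℤ.* v ℤ.+ i
numerator≤ b c k v i k≥0 total≡v = begin
  + b ℤ.* v ℤ.+ weighted c k ℤ.+ i
    ≤⟨ ℤP.+-monoˡ-≤ i (ℤP.+-monoʳ-≤ (+ b ℤ.* v) weighted≤c*v) ⟩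
  + b ℤ.* v ℤ.+ + c ℤ.* v ℤ.+ i
    ≡⟨ cong (ℤ._+ i) (ℤP.*-distribʳ-+ v (+ b) (+ c)) ⟨
  (+ b ℤ.+ + c) ℤ.* v ℤ.+ i
    ≡⟨ cong (λ x → x ℤ.* v ℤ.+ i) (ℤP.pos-+ b c) ⟨
  + (b ℕ.+ c) ℤ.* v ℤ.+ i ∎
  where
  open ℤP.≤-Reasoning
  weighted≤c*v : weighted c k ℤ.≤ + c ℤ.* v
  weighted≤c*v = subst (λ T → weighted c k ℤ.≤ + c ℤ.* T) total≡v (weighted≤c*total c k k≥0)

lemma3p4 : (p a b c : ℕ) → .{{_ : NonZero p}} → Prime p →
    2 ℕ.≤ a → 2 ℕ.≤ c → a ℕ.< p →
    (i j : ℤ) → InN a b c i j →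
    (u v : ℤ) →
    j ℤ.- + 1 ℤ.+ (+ a ℤ.- + 1) ℤ.* (+ p ℤ.- + 1) ≡ + p ℤ.* (u ℤ.- + 1) ℤ.+ + a ℤ.* v →
    + 1 ℤ.≤ u → u ℤ.≤ + a → + 0 ℤ.≤ v → v ℤ.≤ + p ℤ.- + 1 →
    (k : Fin (suc c) → ℤ) →
    (∀ t → + 0 ℤ.≤ k t) → (∀ t → k t ℤ.≤ v) →
    total c k ≡ v →
    (+ p) ∣ (+ b ℤ.* v ℤ.+ weighted c k ℤ.+ i) →
    u ℤ.≤ ceiling (line a (b ℕ.+ c) ((+ b ℤ.* v ℤ.+ weighted c k ℤ.+ i) ℚ./ p)) ℤ.- + 1
lemma3p4 p a b c _ _ 2≤c _ i j ij∈𝒩 u v digits _ _ _ _ k k≥0 _ total≡v _ =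
  Equivalence.from (≤⌈line⌉-1⇔ a (b ℕ.+ c) p u N)
    (below-line-transfer (+ a) (+ p) u v i j (+ (b ℕ.+ c)) N digits
      (numerator≤ b c k v i k≥0 total≡v)
      (Equivalence.to (≤⌈line⌉-1⇔ a (b ℕ.+ c) 1 j i) j-below))
  where
  N = + b ℤ.* v ℤ.+ weighted c k ℤ.+ i
  instance
    b+c≢0 : NonZero (b ℕ.+ c)
    b+c≢0 = ℕ.>-nonZero (ℕP.≤-trans (ℕP.≤-trans (ℕ.s≤s ℕ.z≤n) 2≤c) (ℕP.m≤n+m c b))
  j-below : j ℤ.≤ ceiling (line a (b ℕ.+ c) (ι i)) ℤ.- + 1
  j-below = [ proj₂ ∘ proj₂ , proj₂ ∘ proj₂ ] ij∈𝒩
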